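{- Let $p=(132,\{1\},\emptyset)$ and $r=(132,\emptyset,\{1\})$. Then for every $n\ge 0$, \[\mathrm{Av}_n(p,r)=\mathrm{Av}_n(132).\]
   Context: For $n\ge 0$, $\mathcal{S}_n$ is the set of permutations of $[n]=\{1,\dots,n\}$, written as words $\pi=\pi(1)\pi(2)\cdots\pi(n)$. Two words of distinct integers of the same length are order-isomorphic if their entries appear in the same relative order. A pattern of length 3 is a triple $(\sigma,X,Y)$ with $\sigma\in\mathcal{S}_3$ and $X,Y\subseteq\{1,2\}$. A permutation $\pi\in\mathcal{S}_n$ contains $(\sigma,X,Y)$ if there are indices $i_1<i_2<i_3$ such that $\pi(i_1)\pi(i_2)\pi(i_3)$ is order-isomorphic to $\sigma$, $i_{x+1}=i_x+1$ for every $x\in X$, and $j_{y+1}=j_y+1$ for every $y\in Y$, where $j_1<j_2<j_3$ are the three values $\pi(i_1),\pi(i_2),\pi(i_3)$ listed in increasing order; otherwise $\pi$ avoids it. A classical pattern $\sigma$ means $(\sigma,\emptyset,\emptyset)$. For patterns $P_1,\dots,P_m$, $\mathrm{Av}_n(P_1,\dots,P_m)$ is the set of $\pi\in\mathcal{S}_n$ avoiding every $P_i$. -}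

module Defs where

open import Data.Nat using (ℕ; suc)
open import Data.Fin using (Fin; zero; suc; toℕ; inject₁; _<_)
open import Data.Fin.Permutation using (Permutation′; _⟨$⟩ʳ_; _⟨$⟩ˡ_; transpose)
open import Data.Fin.Subset using (Subset; _∈_; ⁅_⁆; ⊥)
open import Data.Product using (Σ; _×_)
open import Relation.Binary.PropositionalEquality using (_≡_)
open import Relation.Nullary using (¬_)
open import Function.Bundles using (_⇔_)

-- A pattern of length 3: (σ, X, Y) with σ ∈ S₃ and X, Y ⊆ {1,2}.
-- Positions/values are 0-indexed: Fin 3 = {1,2,3}, Fin 2 = {1,2} (x ↦ x-1).
record Pattern : Set where
  constructor pat
  field
    σ : Permutation′ 3
    X : Subset 2
    Y : Subset 2

Occurrence : {n : ℕ} → Permutation′ n → Pattern → (Fin 3 → Fin n) → Set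
Occurrence {n} π (pat σ X Y) i =
  ((a b : Fin 3) → a < b → i a < i b)
  × ((a b : Fin 3) → ((π ⟨$⟩ʳ i a) < (π ⟨$⟩ʳ i b)) ⇔ ((σ ⟨$⟩ʳ a) < (σ ⟨$⟩ʳ b)))
  × ((x : Fin 2) → x ∈ X → toℕ (i (suc x)) ≡ suc (toℕ (i (inject₁ x))))
  -- j_{y+1} = j_y + 1 for y ∈ Y, where j_k = π(i_{σ⁻¹(k)}) is the k-th smallest value
  × ((y : Fin 2) → y ∈ Y → toℕ (j (suc y)) ≡ suc (toℕ (j (inject₁ y))))
  where
  j : Fin 3 → Fin n
  j k = π ⟨$⟩ʳ i (σ ⟨$⟩ˡ k)

Contains : {n : ℕ} → Permutation′ n → Pattern → Set
Contains {n} π P = Σ (Fin 3 → Fin n) (Occurrence π P)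

Avoids : {n : ℕ} → Permutation′ n → Pattern → Set
Avoids π P = ¬ Contains π P

-- the permutation 132 (as a word: 1 ↦ 1, 2 ↦ 3, 3 ↦ 2)
σ132 : Permutation′ 3
σ132 = transpose (suc zero) (suc (suc zero))

classical132 : Pattern
classical132 = pat σ132 ⊥ ⊥

p : Pattern
p = pat σ132 ⁅ zero ⁆ ⊥

r : Pattern
r = pat σ132 ⊥ ⁅ zero ⁆

Av₂ : (n : ℕ) → Pattern → Pattern → Permutation′ n → Set
Av₂ n P Q π = Avoids π P × Avoids π Q

Av₁ : (n : ℕ) → Pattern → Permutation′ n → Set
Av₁ n P π = Avoids π P

-- Every occurrence of 132 at positions x < y < z can be moved to one whose first two
-- positions are adjacent: look at x + 1.  If π(x + 1) < π(z), then (x + 1, y, z) is an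
-- occurrence with a smaller gap; otherwise (x, x + 1, z) is an occurrence of (132, {1}, ∅).
-- Hence avoiding p already forces avoiding 132, and the converse is immediate.
module Submission where

open import Defs
open import Data.Nat using (ℕ; zero; suc; _+_; _∸_; s≤s; z≤n)
open import Data.Nat.Properties using (+-suc; m≤n+m; m∸n+n≡m; ≤-<-trans; ≤-reflexive)
open import Data.Fin using (Fin; zero; suc; toℕ; inject₁; fromℕ<; _<_)
open import Data.Fin.Properties using (<-trans; <-irrefl; <-asym; <-cmp; toℕ<n; toℕ-fromℕ<)
open import Data.Fin.Permutation using (Permutation′; _⟨$⟩ʳ_)
open import Data.Fin.Subset using (Subset; _∈_; ⁅_⁆) renaming (⊥ to ∅)
open import Data.Fin.Subset.Properties using (∉⊥; x∈⁅y⁆⇒x≡y)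
open import Data.Product using (Σ; _,_)
open import Data.Empty using (⊥-elim)
open import Function.Base using (_∘_)
open import Function.Bundles using (_⇔_; mk⇔; Equivalence; Injection)
open import Function.Definitions using (Injective)
open import Function.Properties.Inverse using (↔⇒↣)
open import Relation.Binary.Definitions using (tri<; tri≈; tri>)
open import Relation.Binary.PropositionalEquality using (_≡_; sym; cong; subst; module ≡-Reasoning)

permutation-injective : ∀ {n} (π : Permutation′ n) → Injective _≡_ _≡_ (π ⟨$⟩ʳ_)
permutation-injective π = Injection.injective (↔⇒↣ π)

strictMono⇒orderIso : ∀ {k m n} {f : Fin k → Fin m} {g : Fin k → Fin n} →
                      Injective _≡_ _≡_ g → (∀ a b → g a < g b → f a < f b) →
                      ∀ a b → (f a < f b) ⇔ (g a < g b)
strictMono⇒orderIso {f = f} {g} g-inj mono a b = mk⇔ reflect (mono a b)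
  where
  reflect : f a < f b → g a < g b
  reflect fa<fb with <-cmp (g a) (g b)
  ... | tri< ga<gb _ _ = ga<gb
  ... | tri≈ _ ga≡gb _ = ⊥-elim (<-irrefl (cong f (g-inj ga≡gb)) fa<fb)
  ... | tri> _ _ gb<ga = ⊥-elim (<-asym fa<fb (mono b a gb<ga))

triple : ∀ {n} → Fin n → Fin n → Fin n → Fin 3 → Fin n
triple x y z zero             = x
triple x y z (suc zero)       = y
triple x y z (suc (suc zero)) = z

triple-increasing : ∀ {n} {x y z : Fin n} → x < y → y < z →
                    ∀ a b → a < b → triple x y z a < triple x y z b
triple-increasing x<y y<z zero             (suc zero)       _ = x<y
triple-increasing x<y y<z zero             (suc (suc zero)) _ = <-trans x<y y<z
triple-increasing x<y y<z (suc zero)       (suc (suc zero)) _ = y<z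
triple-increasing x<y y<z (suc zero)       (suc zero)       (s≤s ())
triple-increasing x<y y<z (suc (suc zero)) (suc (suc zero)) (s≤s (s≤s ()))
triple-increasing x<y y<z (suc (suc zero)) (suc zero)       (s≤s ())

triple-orderPreserving132 : ∀ {m n} (f : Fin n → Fin m) {x y z : Fin n} → f x < f z → f z < f y →
                            ∀ a b → σ132 ⟨$⟩ʳ a < σ132 ⟨$⟩ʳ b →
                            f (triple x y z a) < f (triple x y z b)
triple-orderPreserving132 f fx<fz fz<fy zero             (suc zero)       _ = <-trans fx<fz fz<fy
triple-orderPreserving132 f fx<fz fz<fy zero             (suc (suc zero)) _ = fx<fz
triple-orderPreserving132 f fx<fz fz<fy (suc (suc zero)) (suc zero)       _ = fz<fy
triple-orderPreserving132 f fx<fz fz<fy (suc zero)       (suc zero)       (s≤s (s≤s ()))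
triple-orderPreserving132 f fx<fz fz<fy (suc zero)       (suc (suc zero)) (s≤s ())
triple-orderPreserving132 f fx<fz fz<fy (suc (suc zero)) (suc (suc zero)) (s≤s ())

module _ {n : ℕ} (π : Permutation′ n) where

  open ≡-Reasoning

  record Occurrence132 : Set where
    constructor occurrence132
    field
      {x y z} : Fin n
      x<y     : x < y
      y<z     : y < z
      πx<πz   : π ⟨$⟩ʳ x < π ⟨$⟩ʳ z
      πz<πy   : π ⟨$⟩ʳ z < π ⟨$⟩ʳ y

    positions : Fin 3 → Fin n
    positions = triple x y z

  open Occurrence132

  Adjacent : Occurrence132 → Set
  Adjacent o = toℕ (y o) ≡ suc (toℕ (x o))

  contains⇒occurrence132 : ∀ {X Y} → Contains π (pat σ132 X Y) → Occurrence132
  contains⇒occurrence132 (i , increasing , orderIso , _) = occurrence132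
    (increasing zero (suc zero) (s≤s z≤n))
    (increasing (suc zero) (suc (suc zero)) (s≤s (s≤s z≤n)))
    (Equivalence.from (orderIso zero (suc (suc zero))) (s≤s z≤n))
    (Equivalence.from (orderIso (suc (suc zero)) (suc zero)) (s≤s (s≤s z≤n)))

  occurrence132⇒contains : (X : Subset 2) (o : Occurrence132) →
                           (∀ w → w ∈ X → toℕ (positions o (suc w)) ≡ suc (toℕ (positions o (inject₁ w)))) →
                           Contains π (pat σ132 X ∅)
  occurrence132⇒contains X o adjacencies =
    positions o ,
    triple-increasing (x<y o) (y<z o) ,
    strictMono⇒orderIso (permutation-injective σ132)
      (triple-orderPreserving132 (π ⟨$⟩ʳ_) (πx<πz o) (πz<πy o)) ,
    adjacencies ,
    λ _ w∈∅ → ⊥-elim (∉⊥ w∈∅)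

  adjacent⇒contains-p : (o : Occurrence132) → Adjacent o → Contains π p
  adjacent⇒contains-p o adjacent = occurrence132⇒contains ⁅ zero ⁆ o
    λ w w∈⁅0⁆ → subst (λ w → toℕ (positions o (suc w)) ≡ suc (toℕ (positions o (inject₁ w))))
                      (sym (x∈⁅y⁆⇒x≡y zero w∈⁅0⁆)) adjacent

  tighten : (k : ℕ) (o : Occurrence132) → toℕ (y o) ≡ suc (k + toℕ (x o)) → Σ Occurrence132 Adjacent
  tighten zero    o gap = o , gap
  tighten (suc k) (occurrence132 {x} {y} {z} x<y y<z πx<πz πz<πy) gap = step
    where
    x′ : Fin n
    x′ = fromℕ< (≤-<-trans x<y (toℕ<n y))

    toℕx′ : toℕ x′ ≡ suc (toℕ x)
    toℕx′ = toℕ-fromℕ< _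

    x<x′ : x < x′
    x<x′ = ≤-reflexive (sym toℕx′)

    x′<y : x′ < y
    x′<y rewrite toℕx′ | gap = s≤s (s≤s (m≤n+m (toℕ x) k))

    gap′ : toℕ y ≡ suc (k + toℕ x′)
    gap′ = begin
      toℕ y                   ≡⟨ gap ⟩
      suc (suc (k + toℕ x))   ≡⟨ cong suc (+-suc k (toℕ x)) ⟨
      suc (k + suc (toℕ x))   ≡⟨ cong (λ m → suc (k + m)) toℕx′ ⟨
      suc (k + toℕ x′)        ∎

    step : Σ Occurrence132 Adjacent
    step with <-cmp (π ⟨$⟩ʳ x′) (π ⟨$⟩ʳ z)
    ... | tri< πx′<πz _ _ = tighten k (occurrence132 x′<y y<z πx′<πz πz<πy) gap′
    ... | tri≈ _ πx′≡πz _ = ⊥-elim (<-asym y<z (subst (_< y) (permutation-injective π πx′≡πz) x′<y))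
    ... | tri> _ _ πz<πx′ = occurrence132 x<x′ (<-trans x′<y y<z) πx<πz πz<πx′ , toℕx′

  adjacentOccurrence132 : Occurrence132 → Σ Occurrence132 Adjacent
  adjacentOccurrence132 o = tighten (toℕ (y o) ∸ suc (toℕ (x o))) o (begin
    toℕ (y o)                                        ≡⟨ m∸n+n≡m (x<y o) ⟨
    toℕ (y o) ∸ suc (toℕ (x o)) + suc (toℕ (x o))    ≡⟨ +-suc _ (toℕ (x o)) ⟩
    suc (toℕ (y o) ∸ suc (toℕ (x o)) + toℕ (x o))    ∎)

  contains132⇒contains-p : Contains π classical132 → Contains π p
  contains132⇒contains-p c with adjacentOccurrence132 (contains⇒occurrence132 c)
  ... | o , adjacent = adjacent⇒contains-p o adjacent

  contains⇒contains132 : ∀ {X Y} → Contains π (pat σ132 X Y) → Contains π classical132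
  contains⇒contains132 c = occurrence132⇒contains ∅ (contains⇒occurrence132 c) (λ _ w∈∅ → ⊥-elim (∉⊥ w∈∅))

proposition7 : (n : ℕ) → (π : Permutation′ n) → Av₂ n p r π ⇔ Av₁ n classical132 π
proposition7 n π = mk⇔
  (λ (avoids-p , _) → avoids-p ∘ contains132⇒contains-p π)
  (λ avoids132 → avoids132 ∘ contains⇒contains132 π , avoids132 ∘ contains⇒contains132 π)
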